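{- For $n\geqslant 1$, let $$\mathcal{F}_n=\{F\subset\{1,\ldots,n\}:\ F\text{ is Schreier and sparse},\ n\in F\}.$$ Then $|\mathcal{F}_n|=p(n-1)$, where $p(u)$ is the number of partitions of $u$, with the convention $p(0)=1$.
   Context: A set $A\subset\mathbb{N}$ is Schreier if $A$ is empty or $\min A\geqslant |A|$. A set $A=\{a_1<\cdots<a_n\}\subset\mathbb{N}$ is sparse if either $|A|\leqslant 2$, or $|A|\geqslant 3$ and $a_i-a_{i-1}\geqslant a_{i-1}-a_{i-2}$ for all $3\leqslant i\leqslant n$. -}

module Defs where

open import Data.Nat using (ℕ; zero; suc; _+_; _∸_; _≤_; _<_; _≟_)
open import Data.Nat.Properties using (_≤?_; _<?_)
open import Data.Bool using (Bool; true; false; _∧_; T)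
open import Data.Bool using (_∨_)
open import Data.List using (List; []; _∷_; length)
open import Data.Nat.ListAction using (sum)

all : {A : Set} → (A → Bool) → List A → Bool
all p [] = true
all p (x ∷ l) = p x ∧ all p l
open import Data.Product using (Σ)
open import Relation.Nullary.Decidable using (⌊_⌋)

-- Finite subsets of ℕ = {1,2,...} are represented canonically as
-- strictly increasing lists of positive naturals (one list per set).

increasing : List ℕ → Bool
increasing [] = true
increasing (a ∷ []) = true
increasing (a ∷ b ∷ l) = ⌊ a <? b ⌋ ∧ increasing (b ∷ l)

inRange : ℕ → List ℕ → Bool
inRange n = all (λ a → ⌊ 1 ≤? a ⌋ ∧ ⌊ a ≤? n ⌋)

member : ℕ → List ℕ → Bool
member n [] = false
member n (a ∷ l) = ⌊ a ≟ n ⌋ ∨ member n l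

-- Schreier: empty or min A ≥ |A|  (min of an increasing list is its head)
schreier : List ℕ → Bool
schreier [] = true
schreier (a ∷ l) = ⌊ length (a ∷ l) ≤? a ⌋

-- Sparse: consecutive gaps non-decreasing: a_i - a_{i-1} ≥ a_{i-1} - a_{i-2}
-- (vacuous for |A| ≤ 2). Applied to increasing lists, ∸ is true subtraction.
sparse : List ℕ → Bool
sparse (a ∷ b ∷ c ∷ l) = ⌊ b ∸ a ≤? c ∸ b ⌋ ∧ sparse (b ∷ c ∷ l)
sparse _ = true

isFn : ℕ → List ℕ → Bool
isFn n F = increasing F ∧ inRange n F ∧ schreier F ∧ sparse F ∧ member n F

𝓕 : ℕ → Set
𝓕 n = Σ (List ℕ) (λ F → T (isFn n F))

-- Partitions of u: non-increasing lists of positive integers summing to u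
-- (the empty list is the unique partition of 0, so p(0) = 1).
nonIncreasing : List ℕ → Bool
nonIncreasing (a ∷ b ∷ l) = ⌊ b ≤? a ⌋ ∧ nonIncreasing (b ∷ l)
nonIncreasing _ = true

isPartition : ℕ → List ℕ → Bool
isPartition u l = nonIncreasing l ∧ all (λ a → ⌊ 1 ≤? a ⌋) l ∧ ⌊ sum l ≟ u ⌋

Partition : ℕ → Set
Partition u = Σ (List ℕ) (λ l → T (isPartition u l))

-- Write F ∈ 𝓕ₙ as a₁ < ⋯ < aₘ = n, i.e. as the partial sums of a₁ and the gaps dᵢ = aᵢ₊₁ − aᵢ ≥ 1.
-- Sparseness says that the gaps are non-decreasing, the Schreier condition that c = a₁ − m ≥ 0.
-- As a₁ + Σ dᵢ = n, the c ones together with the parts dᵢ + 1 ≥ 2 form a partition of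
-- c + Σ dᵢ + (m − 1) = n − 1. Conversely a partition of n − 1 determines c as its number of ones and
-- the gaps from its parts ≥ 2, hence also m and a₁ = c + m. Finally 𝓕ₙ is finite, being cut out of
-- the words of length ≤ n over {0, …, n}.
module Submission where

open import Defs
open import Data.Bool using (Bool; T; _∧_)
open import Data.Bool.Properties using (T-∧; T-∨; T-irrelevant)
open import Data.Empty using (⊥-elim)
open import Data.Fin using (Fin; zero; suc)
open import Data.List
  using (List; []; _∷_; [_]; length; lookup; map; replicate; _++_; reverse; _ʳ++_; upTo; deduplicate; cartesianProductWith)
open import Data.List.Membership.Propositional using (_∈_)
open import Data.List.Membership.Propositional.Properties using (∈-lookup; ∈-cartesianProductWith⁺; ∈-upTo⁺)
open import Data.List.Properties using (map-∘; map-id; map-id-local; ≡-dec; reverse-involutive)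
open import Data.List.Relation.Binary.Permutation.Propositional using (↭-sym)
open import Data.List.Relation.Binary.Permutation.Propositional.Properties using (↭-reverse; All-resp-↭)
open import Data.List.Relation.Unary.All as All using (All; []; _∷_)
import Data.List.Relation.Unary.All.Properties as All
open import Data.List.Relation.Unary.Any using (here; there)
open import Data.List.Relation.Unary.Enumerates.Setoid.Properties using (deduplicate⁺; lookup-surjective)
open import Data.List.Relation.Unary.Linked as Linked using (Linked; []; [-]; _∷_)
import Data.List.Relation.Unary.Linked.Properties as Linked
open import Data.List.Relation.Unary.Unique.Propositional using (Unique; []; _∷_)
open import Data.List.Relation.Unary.Unique.DecPropositional.Properties using (deduplicate-!)
open import Data.List.Scans.Base using (scanl)
open import Data.Nat using (ℕ; zero; suc; pred; _+_; _∸_; _≤_; _<_; _≥_; z≤n; s≤s; _≟_)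
open import Data.Nat.ListAction using (sum)
open import Data.Nat.ListAction.Properties using (sum-↭)
open import Data.Nat.Properties
  using (_≤?_; _<?_; ≤-refl; ≤-reflexive; ≤-trans; ≤-antisym; <⇒≤; <-irrefl; +-identityʳ; +-assoc; +-comm; +-suc; m≤m+n; m≤n+m; m<m+n
        ; m+n∸m≡n; m+n∸n≡m; m+[n∸m]≡n; m∸n+n≡m; suc-injective; pred-mono-≤)
open import Data.Product using (Σ; _×_; _,_; proj₁; proj₂; map₁; uncurry)
open import Data.Sum using (inj₁; inj₂)
open import Data.Unit using (tt)
open import Function.Bundles using (_↔_; Equivalence; mk⤖; mk↔ₛ′)
open import Function.Definitions using (Injective)
open import Function.Properties.Bijection using (⤖⇒↔)
open import Function.Properties.Inverse using (↔-trans)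
open import Relation.Binary.Definitions using (DecidableEquality)
open import Relation.Binary.PropositionalEquality
  using (_≡_; refl; sym; trans; cong; cong₂; subst; subst₂; setoid; decSetoid; module ≡-Reasoning)
open import Relation.Nullary.Decidable using (⌊_⌋; yes; no; map′; T?; toWitness; fromWitness)

private
  variable
    A : Set

lookup-injective : {xs : List A} → Unique xs → Injective _≡_ _≡_ (lookup xs)
lookup-injective (_ ∷ _)         {zero}  {zero}  _       = refl
lookup-injective (x∉xs ∷ _)      {zero}  {suc j} x≡xsⱼ   = ⊥-elim (All.lookup x∉xs (∈-lookup j) x≡xsⱼ)
lookup-injective (x∉xs ∷ _)      {suc i} {zero}  xsᵢ≡x   = ⊥-elim (All.lookup x∉xs (∈-lookup i) (sym xsᵢ≡x))
lookup-injective (_ ∷ xs-unique) {suc i} {suc j} xsᵢ≡xsⱼ = cong suc (lookup-injective xs-unique xsᵢ≡xsⱼ)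

enumeration⇒↔Fin : {A : Set} → DecidableEquality A → (xs : List A) → (∀ x → x ∈ xs) → Σ ℕ (λ k → Fin k ↔ A)
enumeration⇒↔Fin {A} _≟_ xs xs-complete =
  length ys , ⤖⇒↔ (mk⤖ (lookup-injective (deduplicate-! _≟_ xs) , lookup-surjective (setoid _) ys-complete))
  where
  ys : List A
  ys = deduplicate _≟_ xs
  ys-complete : ∀ x → x ∈ ys
  ys-complete = deduplicate⁺ (decSetoid _≟_) xs-complete

words : ℕ → List A → List (List A)
words zero    alphabet = [ [] ]
words (suc L) alphabet = [] ∷ cartesianProductWith _∷_ alphabet (words L alphabet)

∈-words⁺ : ∀ {L alphabet} {w : List A} → All (_∈ alphabet) w → length w ≤ L → w ∈ words L alphabet
∈-words⁺ {L = zero}  []         z≤n         = here refl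
∈-words⁺ {L = suc L} []         _           = here refl
∈-words⁺ {L = suc L} (x∈ ∷ w⊆)  (s≤s |w|≤L) =
  there (∈-cartesianProductWith⁺ _∷_ x∈ (∈-words⁺ w⊆ |w|≤L))

module _ {p : A → Bool} where

  subtype-≡ : ∀ {x y} {px : T (p x)} {py : T (p y)} → x ≡ y → _≡_ {A = Σ A (λ x → T (p x))} (x , px) (y , py)
  subtype-≡ refl = cong (_ ,_) (T-irrelevant _ _)

  subtype-≟ : DecidableEquality A → DecidableEquality (Σ A (λ x → T (p x)))
  subtype-≟ _≟_ (x , _) (y , _) = map′ subtype-≡ (cong proj₁) (x ≟ y)

  restrict : List A → List (Σ A (λ x → T (p x)))
  restrict []       = []
  restrict (x ∷ xs) with T? (p x)
  ... | yes px = (x , px) ∷ restrict xs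
  ... | no  _  = restrict xs

  ∈-restrict⁺ : ∀ {x xs} (px : T (p x)) → x ∈ xs → (x , px) ∈ restrict xs
  ∈-restrict⁺ {xs = x ∷ _} px (here refl) with T? (p x)
  ... | yes _  = here (subtype-≡ refl)
  ... | no ¬px = ⊥-elim (¬px px)
  ∈-restrict⁺ {xs = y ∷ _} px (there x∈xs) with T? (p y)
  ... | yes _ = there (∈-restrict⁺ px x∈xs)
  ... | no  _ = ∈-restrict⁺ px x∈xs

subtype-↔ : {p q : A → Bool} (f g : A → A) →
  (∀ {x} → T (p x) → T (q (f x))) → (∀ {y} → T (q y) → T (p (g y))) →
  (∀ {y} → T (q y) → f (g y) ≡ y) → (∀ {x} → T (p x) → g (f x) ≡ x) →
  Σ A (λ x → T (p x)) ↔ Σ A (λ y → T (q y))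
subtype-↔ f g f-resp g-resp f∘g g∘f = mk↔ₛ′
  (λ (x , px) → f x , f-resp px) (λ (y , qy) → g y , g-resp qy)
  (λ (_ , qy) → subtype-≡ (f∘g qy)) (λ (_ , px) → subtype-≡ (g∘f px))

-- The decisions ⌊ m ≤? n ⌋ in Defs unfold during type checking, so Agda often cannot recover the
-- conjuncts of a T (x ∧ y) by unification; below they are then supplied explicitly.
∧⁺ : ∀ {x y} → T x × T y → T (x ∧ y)
∧⁺ = Equivalence.from T-∧

∧⁻ : ∀ {x y} → T (x ∧ y) → T x × T y
∧⁻ = Equivalence.to T-∧

isFn⁺ : ∀ n F →
  T (increasing F) × T (inRange n F) × T (schreier F) × T (sparse F) × T (member n F) → T (isFn n F)
isFn⁺ n F (inc , rng , sch , sp , mem) = ∧⁺ (inc , ∧⁺ (rng , ∧⁺ (sch , ∧⁺ (sp , mem))))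

isFn⁻ : ∀ n F → T (isFn n F) →
  T (increasing F) × T (inRange n F) × T (schreier F) × T (sparse F) × T (member n F)
isFn⁻ n F F∈𝓕 =
  let inc , rng∧sch∧sp∧mem = ∧⁻ F∈𝓕
      rng , sch∧sp∧mem     = ∧⁻ rng∧sch∧sp∧mem
      sch , sp∧mem         = ∧⁻ sch∧sp∧mem
  in inc , rng , sch , ∧⁻ sp∧mem

inRange⇒All : ∀ n l → T (inRange n l) → All (λ a → 1 ≤ a × a ≤ n) l
inRange⇒All n []      _   = []
inRange⇒All n (a ∷ l) rng =
  let a∈ , rng′ = ∧⁻ {⌊ 1 ≤? a ⌋ ∧ ⌊ a ≤? n ⌋} rng
      1≤a , a≤n = ∧⁻ {⌊ 1 ≤? a ⌋} a∈
  in (toWitness 1≤a , toWitness a≤n) ∷ inRange⇒All n l rng′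

All⇒inRange : ∀ n l → All (λ a → 1 ≤ a × a ≤ n) l → T (inRange n l)
All⇒inRange n []      []                   = tt
All⇒inRange n (a ∷ l) ((1≤a , a≤n) ∷ l∈) =
  ∧⁺ {⌊ 1 ≤? a ⌋ ∧ ⌊ a ≤? n ⌋}
     (∧⁺ {⌊ 1 ≤? a ⌋} (fromWitness 1≤a , fromWitness a≤n) , All⇒inRange n l l∈)

member⇒∈ : ∀ n l → T (member n l) → n ∈ l
member⇒∈ n (a ∷ l) mem with Equivalence.to (T-∨ {⌊ a ≟ n ⌋}) mem
... | inj₁ a≡n  = here (sym (toWitness a≡n))
... | inj₂ mem′ = there (member⇒∈ n l mem′)

∈⇒member : ∀ n l → n ∈ l → T (member n l)
∈⇒member n (a ∷ l) (here n≡a)  = Equivalence.from (T-∨ {⌊ a ≟ n ⌋}) (inj₁ (fromWitness (sym n≡a)))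
∈⇒member n (a ∷ l) (there n∈l) = Equivalence.from (T-∨ {⌊ a ≟ n ⌋}) (inj₂ (∈⇒member n l n∈l))

allPositive⇒All : ∀ l → T (all (λ a → ⌊ 1 ≤? a ⌋) l) → All (1 ≤_) l
allPositive⇒All []      _   = []
allPositive⇒All (a ∷ l) pos =
  let 1≤a , pos′ = ∧⁻ {⌊ 1 ≤? a ⌋} pos in toWitness 1≤a ∷ allPositive⇒All l pos′

All⇒allPositive : ∀ l → All (1 ≤_) l → T (all (λ a → ⌊ 1 ≤? a ⌋) l)
All⇒allPositive []      []           = tt
All⇒allPositive (a ∷ l) (1≤a ∷ 1≤l) = ∧⁺ {⌊ 1 ≤? a ⌋} (fromWitness 1≤a , All⇒allPositive l 1≤l)

nonIncreasing-ʳ++⁺ : ∀ x xs acc →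
  Linked _≤_ (x ∷ xs) → T (nonIncreasing (x ∷ acc)) → T (nonIncreasing (xs ʳ++ (x ∷ acc)))
nonIncreasing-ʳ++⁺ x []       acc _             ni = ni
nonIncreasing-ʳ++⁺ x (y ∷ xs) acc (x≤y ∷ y∷xs↗) ni =
  nonIncreasing-ʳ++⁺ y xs (x ∷ acc) y∷xs↗ (∧⁺ {⌊ x ≤? y ⌋} (fromWitness x≤y , ni))

nonIncreasing-ʳ++⁻ : ∀ x xs acc →
  T (nonIncreasing (x ∷ xs)) → Linked _≤_ (x ∷ acc) → Linked _≤_ (xs ʳ++ (x ∷ acc))
nonIncreasing-ʳ++⁻ x []       acc _  x∷acc↗ = x∷acc↗
nonIncreasing-ʳ++⁻ x (y ∷ xs) acc ni x∷acc↗ =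
  let y≤x , ni′ = ∧⁻ {⌊ y ≤? x ⌋} ni
  in nonIncreasing-ʳ++⁻ y xs (x ∷ acc) ni′ (toWitness y≤x ∷ x∷acc↗)

nonIncreasing-reverse⁺ : ∀ l → Linked _≤_ l → T (nonIncreasing (reverse l))
nonIncreasing-reverse⁺ []      _  = tt
nonIncreasing-reverse⁺ (x ∷ l) l↗ = nonIncreasing-ʳ++⁺ x l [] l↗ tt

nonIncreasing-reverse⁻ : ∀ l → T (nonIncreasing l) → Linked _≤_ (reverse l)
nonIncreasing-reverse⁻ []      _  = []
nonIncreasing-reverse⁻ (x ∷ l) ni = nonIncreasing-ʳ++⁻ x l [] ni [-]

gaps : List ℕ → List ℕ
gaps (a ∷ b ∷ l) = b ∸ a ∷ gaps (b ∷ l)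
gaps _           = []

gaps-scanl : ∀ a ds → gaps (scanl _+_ a ds) ≡ ds
gaps-scanl a []       = refl
gaps-scanl a (d ∷ ds) = cong₂ _∷_ (m+n∸m≡n a d) (gaps-scanl (a + d) ds)

scanl-gaps : ∀ a l → T (increasing (a ∷ l)) → scanl _+_ a (gaps (a ∷ l)) ≡ a ∷ l
scanl-gaps a []      _   = refl
scanl-gaps a (b ∷ l) inc =
  let a<b , inc′ = ∧⁻ inc
      a+[b∸a]≡b = m+[n∸m]≡n (<⇒≤ (toWitness a<b))
  in cong (a ∷_) (trans (cong (λ c → scanl _+_ c (gaps (b ∷ l))) a+[b∸a]≡b) (scanl-gaps b l inc′))

length-scanl : ∀ a ds → length (scanl _+_ a ds) ≡ suc (length ds)
length-scanl a []       = refl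
length-scanl a (d ∷ ds) = cong suc (length-scanl (a + d) ds)

total-∈-scanl : ∀ a ds → a + sum ds ∈ scanl _+_ a ds
total-∈-scanl a []       = here (+-identityʳ a)
total-∈-scanl a (d ∷ ds) = there (subst (_∈ scanl _+_ (a + d) ds) (+-assoc a d (sum ds)) (total-∈-scanl (a + d) ds))

scanl-between : ∀ a ds → All (λ x → a ≤ x × x ≤ a + sum ds) (scanl _+_ a ds)
scanl-between a []       = (≤-refl , m≤m+n a 0) ∷ []
scanl-between a (d ∷ ds) = (≤-refl , m≤m+n a (d + sum ds)) ∷ All.map widen (scanl-between (a + d) ds)
  where
  widen : ∀ {x} → a + d ≤ x × x ≤ a + d + sum ds → a ≤ x × x ≤ a + (d + sum ds)
  widen (a+d≤x , x≤total) = ≤-trans (m≤m+n a d) a+d≤x , ≤-trans x≤total (≤-reflexive (+-assoc a d (sum ds)))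

increasing-scanl⁺ : ∀ a ds → All (1 ≤_) ds → T (increasing (scanl _+_ a ds))
increasing-scanl⁺ a []       []           = tt
increasing-scanl⁺ a (d ∷ ds) (1≤d ∷ 1≤ds) =
  ∧⁺ (fromWitness (m<m+n a 1≤d) , increasing-scanl⁺ (a + d) ds 1≤ds)

increasing-scanl⁻ : ∀ a ds → T (increasing (scanl _+_ a ds)) → All (1 ≤_) ds
increasing-scanl⁻ a []           _   = []
increasing-scanl⁻ a (zero ∷ ds)  inc =
  ⊥-elim (<-irrefl (sym (+-identityʳ a)) (toWitness (proj₁ (∧⁻ {⌊ a <? a + 0 ⌋} inc))))
increasing-scanl⁻ a (suc d ∷ ds) inc = s≤s z≤n ∷ increasing-scanl⁻ (a + suc d) ds (proj₂ (∧⁻ inc))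

sparse-scanl⁺ : ∀ a ds → Linked _≤_ ds → T (sparse (scanl _+_ a ds))
sparse-scanl⁺ a []           []           = tt
sparse-scanl⁺ a (d ∷ [])     [-]          = tt
sparse-scanl⁺ a (d ∷ e ∷ ds) (d≤e ∷ e∷ds↗) =
  ∧⁺ ( fromWitness (subst₂ _≤_ (sym (m+n∸m≡n a d)) (sym (m+n∸m≡n (a + d) e)) d≤e)
     , sparse-scanl⁺ (a + d) (e ∷ ds) e∷ds↗)

sparse-scanl⁻ : ∀ a ds → T (sparse (scanl _+_ a ds)) → Linked _≤_ ds
sparse-scanl⁻ a []           _  = []
sparse-scanl⁻ a (d ∷ [])     _  = [-]
sparse-scanl⁻ a (d ∷ e ∷ ds) sp =
  let d≤e , sp′ = ∧⁻ sp
  in subst₂ _≤_ (m+n∸m≡n a d) (m+n∸m≡n (a + d) e) (toWitness d≤e) ∷ sparse-scanl⁻ (a + d) (e ∷ ds) sp′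

record GapCode (n a : ℕ) (ds : List ℕ) : Set where
  field
    gaps-positive  : All (1 ≤_) ds
    gaps-ascending : Linked _≤_ ds
    schreier-bound : length ds < a
    total          : a + sum ds ≡ n

isFn-scanl⁻ : ∀ n a ds → T (isFn n (scanl _+_ a ds)) → GapCode n a ds
isFn-scanl⁻ n a ds F∈𝓕 with isFn⁻ n (scanl _+_ a ds) F∈𝓕
... | inc , rng , sch , sp , mem = record
  { gaps-positive  = increasing-scanl⁻ a ds inc
  ; gaps-ascending = sparse-scanl⁻ a ds sp
  ; schreier-bound = subst (_≤ a) (length-scanl a ds) (toWitness sch)
  ; total          = ≤-antisym (proj₂ (All.lookup (inRange⇒All n _ rng) (total-∈-scanl a ds)))
                               (proj₂ (All.lookup (scanl-between a ds) (member⇒∈ n _ mem)))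
  }

isFn-scanl⁺ : ∀ n a ds → GapCode n a ds → T (isFn n (scanl _+_ a ds))
isFn-scanl⁺ n a ds code = isFn⁺ n (scanl _+_ a ds)
  ( increasing-scanl⁺ a ds gaps-positive
  , All⇒inRange n _ (All.map (λ (a≤x , x≤a+Σ) → ≤-trans 1≤a a≤x , ≤-trans x≤a+Σ (≤-reflexive total)) (scanl-between a ds))
  , fromWitness (subst (_≤ a) (sym (length-scanl a ds)) schreier-bound)
  , sparse-scanl⁺ a ds gaps-ascending
  , ∈⇒member n _ (subst (_∈ scanl _+_ a ds) total (total-∈-scanl a ds)))
  where
  open GapCode code
  1≤a : 1 ≤ a
  1≤a = ≤-trans (s≤s z≤n) schreier-bound

record IsAscendingPartition (u : ℕ) (ρ : List ℕ) : Set where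
  field
    ascending : Linked _≤_ ρ
    positive  : All (1 ≤_) ρ
    sum≡      : sum ρ ≡ u

reverse-isPartition : ∀ u ρ → IsAscendingPartition u ρ → T (isPartition u (reverse ρ))
reverse-isPartition u ρ ρ-part = ∧⁺
  ( nonIncreasing-reverse⁺ ρ ascending
  , ∧⁺ ( All⇒allPositive (reverse ρ) (All-resp-↭ (↭-sym (↭-reverse ρ)) positive)
       , fromWitness (trans (sum-↭ (↭-reverse ρ)) sum≡)))
  where open IsAscendingPartition ρ-part

isPartition-reverse : ∀ u π → T (isPartition u π) → IsAscendingPartition u (reverse π)
isPartition-reverse u π π-part =
  let ni , pos∧sum = ∧⁻ π-part
      pos , sum≡u  = ∧⁻ pos∧sum
  in record
    { ascending = nonIncreasing-reverse⁻ π ni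
    ; positive  = All-resp-↭ (↭-sym (↭-reverse π)) (allPositive⇒All π pos)
    ; sum≡      = trans (sum-↭ (↭-reverse π)) (toWitness sum≡u)
    }

joinOnes : ℕ → List ℕ → List ℕ
joinOnes c ds = replicate c 1 ++ map suc ds

splitOnes : List ℕ → ℕ × List ℕ
splitOnes (1 ∷ ρ) = map₁ suc (splitOnes ρ)
splitOnes ρ       = 0 , map pred ρ

sum-map-suc : ∀ ds → sum (map suc ds) ≡ sum ds + length ds
sum-map-suc []       = refl
sum-map-suc (d ∷ ds) = begin
  suc (d + sum (map suc ds))     ≡⟨ cong (λ s → suc (d + s)) (sum-map-suc ds) ⟩
  suc (d + (sum ds + length ds)) ≡⟨ cong suc (+-assoc d (sum ds) (length ds)) ⟨
  suc (d + sum ds + length ds)   ≡⟨ +-suc (d + sum ds) (length ds) ⟨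
  d + sum ds + suc (length ds)   ∎
  where open ≡-Reasoning

sum-joinOnes : ∀ c ds → sum (joinOnes c ds) ≡ c + (sum ds + length ds)
sum-joinOnes zero    ds = sum-map-suc ds
sum-joinOnes (suc c) ds = cong suc (sum-joinOnes c ds)

joinOnes-positive : ∀ c ds → All (1 ≤_) (joinOnes c ds)
joinOnes-positive c ds = All.++⁺ (All.replicate⁺ c ≤-refl) (All.map⁺ (All.universal (λ _ → s≤s z≤n) ds))

∷-ascending : ∀ {x l} → All (x ≤_) l → Linked _≤_ l → Linked _≤_ (x ∷ l)
∷-ascending []        _  = [-]
∷-ascending (x≤y ∷ _) l↗ = x≤y ∷ l↗

joinOnes-ascending : ∀ c ds → Linked _≤_ ds → Linked _≤_ (joinOnes c ds)
joinOnes-ascending zero    ds ds↗ = Linked.map⁺ (Linked.map s≤s ds↗)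
joinOnes-ascending (suc c) ds ds↗ = ∷-ascending (joinOnes-positive c ds) (joinOnes-ascending c ds ds↗)

splitOnes-joinOnes : ∀ c ds → All (1 ≤_) ds → splitOnes (joinOnes c ds) ≡ (c , ds)
splitOnes-joinOnes (suc c) ds       1≤ds        = cong (map₁ suc) (splitOnes-joinOnes c ds 1≤ds)
splitOnes-joinOnes zero    []       []          = refl
splitOnes-joinOnes zero    (d ∷ ds) (s≤s _ ∷ _) = cong (0 ,_) (trans (sym (map-∘ (d ∷ ds))) (map-id (d ∷ ds)))

splitOnes-ascending : ∀ ρ → Linked _≤_ ρ → All (1 ≤_) ρ →
  uncurry joinOnes (splitOnes ρ) ≡ ρ × All (1 ≤_) (proj₂ (splitOnes ρ)) × Linked _≤_ (proj₂ (splitOnes ρ))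
splitOnes-ascending []                _  _           = refl , [] , []
splitOnes-ascending (zero ∷ ρ)        _  (() ∷ _)
splitOnes-ascending (1 ∷ ρ)           ρ↗ (_ ∷ 1≤ρ)   =
  let ρ≡ , rest = splitOnes-ascending ρ (Linked.tail ρ↗) 1≤ρ in cong (1 ∷_) ρ≡ , rest
splitOnes-ascending ρ@(suc (suc _) ∷ _) ρ↗ _ =
    trans (sym (map-∘ ρ)) (map-id-local (All.map (λ { (s≤s _) → refl }) 2≤ρ))
  , All.map⁺ (All.map pred-mono-≤ 2≤ρ)
  , Linked.map⁺ (Linked.map pred-mono-≤ ρ↗)
  where
  2≤ρ : All (2 ≤_) ρ
  2≤ρ = Linked.Linked⇒All ≤-trans (s≤s (s≤s z≤n)) ρ↗

suc[m+o]+n≡suc[m+[n+o]] : ∀ m n o → suc (m + o) + n ≡ suc (m + (n + o))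
suc[m+o]+n≡suc[m+[n+o]] m n o = cong suc (trans (+-assoc m o n) (cong (m +_) (+-comm o n)))

toParts : List ℕ → List ℕ
toParts []          = []
toParts F@(a ∷ _)   = joinOnes (a ∸ length F) (gaps F)

fromOnesGaps : ℕ → List ℕ → List ℕ
fromOnesGaps c ds = scanl _+_ (suc (c + length ds)) ds

fromParts : List ℕ → List ℕ
fromParts ρ = uncurry fromOnesGaps (splitOnes ρ)

toParts-scanl : ∀ a ds → toParts (scanl _+_ a ds) ≡ joinOnes (a ∸ suc (length ds)) ds
toParts-scanl a ds = cong₂ joinOnes (cong (a ∸_) (length-scanl a ds)) (gaps-scanl a ds)

toParts-fromOnesGaps : ∀ c ds → toParts (fromOnesGaps c ds) ≡ joinOnes c ds
toParts-fromOnesGaps c ds =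
  trans (toParts-scanl (suc (c + length ds)) ds) (cong (λ c′ → joinOnes c′ ds) (m+n∸n≡m c (length ds)))

isFn⇒scanl : ∀ n F → T (isFn n F) → Σ ℕ λ a → Σ (List ℕ) λ ds → F ≡ scanl _+_ a ds × GapCode n a ds
isFn⇒scanl n F F∈𝓕 with isFn⁻ n F F∈𝓕
isFn⇒scanl n []      _   | _ , _ , _ , _ , ()
isFn⇒scanl n (a ∷ l) F∈𝓕 | inc , _ =
  a , gaps (a ∷ l) , sym F≡ , isFn-scanl⁻ n a (gaps (a ∷ l)) (subst (λ F → T (isFn n F)) (sym F≡) F∈𝓕)
  where
  F≡ : scanl _+_ a (gaps (a ∷ l)) ≡ a ∷ l
  F≡ = scanl-gaps a l inc

module _ {n a ds} (code : GapCode n a ds) where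
  open GapCode code

  onesCount : ℕ
  onesCount = a ∸ suc (length ds)

  suc[onesCount+length]≡first : suc (onesCount + length ds) ≡ a
  suc[onesCount+length]≡first = trans (sym (+-suc onesCount (length ds))) (m∸n+n≡m schreier-bound)

  fromOnesGaps-onesCount : fromOnesGaps onesCount ds ≡ scanl _+_ a ds
  fromOnesGaps-onesCount = cong (λ a′ → scanl _+_ a′ ds) suc[onesCount+length]≡first

joinOnes-isAscendingPartition : ∀ {m a ds} (code : GapCode (suc m) a ds) →
  IsAscendingPartition m (joinOnes (onesCount code) ds)
joinOnes-isAscendingPartition {m} {a} {ds} code = record
  { ascending = joinOnes-ascending c ds gaps-ascending
  ; positive  = joinOnes-positive c ds
  ; sum≡      = suc-injective (begin
      suc (sum (joinOnes c ds))      ≡⟨ cong suc (sum-joinOnes c ds) ⟩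
      suc (c + (sum ds + length ds)) ≡⟨ suc[m+o]+n≡suc[m+[n+o]] c (sum ds) (length ds) ⟨
      suc (c + length ds) + sum ds   ≡⟨ cong (_+ sum ds) (suc[onesCount+length]≡first code) ⟩
      a + sum ds                     ≡⟨ total ⟩
      suc m                          ∎)
  }
  where
  open GapCode code
  open ≡-Reasoning
  c : ℕ
  c = onesCount code

fromOnesGaps-isFn : ∀ m c ds → All (1 ≤_) ds → Linked _≤_ ds → c + (sum ds + length ds) ≡ m →
  T (isFn (suc m) (fromOnesGaps c ds))
fromOnesGaps-isFn m c ds 1≤ds ds↗ c+Σ≡m = isFn-scanl⁺ (suc m) (suc (c + length ds)) ds record
  { gaps-positive  = 1≤ds
  ; gaps-ascending = ds↗
  ; schreier-bound = s≤s (m≤n+m (length ds) c)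
  ; total          = trans (suc[m+o]+n≡suc[m+[n+o]] c (sum ds) (length ds)) (cong suc c+Σ≡m)
  }

toParts-isAscendingPartition : ∀ m F → T (isFn (suc m) F) → IsAscendingPartition m (toParts F)
toParts-isAscendingPartition m F F∈𝓕 with isFn⇒scanl (suc m) F F∈𝓕
... | a , ds , refl , code = subst (IsAscendingPartition m) (sym (toParts-scanl a ds)) (joinOnes-isAscendingPartition code)

fromParts-toParts : ∀ n F → T (isFn n F) → fromParts (toParts F) ≡ F
fromParts-toParts n F F∈𝓕 with isFn⇒scanl n F F∈𝓕
... | a , ds , refl , code = begin
  fromParts (toParts (scanl _+_ a ds)) ≡⟨ cong fromParts (toParts-scanl a ds) ⟩
  fromParts (joinOnes c ds)            ≡⟨ cong (uncurry fromOnesGaps) (splitOnes-joinOnes c ds (GapCode.gaps-positive code)) ⟩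
  fromOnesGaps c ds                    ≡⟨ fromOnesGaps-onesCount code ⟩
  scanl _+_ a ds                       ∎
  where
  open ≡-Reasoning
  c : ℕ
  c = onesCount code

fromParts-isFn : ∀ m ρ → IsAscendingPartition m ρ → T (isFn (suc m) (fromParts ρ))
fromParts-isFn m ρ ρ-part =
  let ρ≡ , 1≤es , es↗ = splitOnes-ascending ρ ascending positive
      c , es = splitOnes ρ
  in fromOnesGaps-isFn m c es 1≤es es↗ (trans (sym (sum-joinOnes c es)) (trans (cong sum ρ≡) sum≡))
  where open IsAscendingPartition ρ-part

toParts-fromParts : ∀ ρ → Linked _≤_ ρ → All (1 ≤_) ρ → toParts (fromParts ρ) ≡ ρ
toParts-fromParts ρ ρ↗ 1≤ρ =
  trans (toParts-fromOnesGaps (proj₁ (splitOnes ρ)) (proj₂ (splitOnes ρ))) (proj₁ (splitOnes-ascending ρ ρ↗ 1≤ρ))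

𝓕↔Partition : ∀ m → 𝓕 (suc m) ↔ Partition m
𝓕↔Partition m = subtype-↔ (λ F → reverse (toParts F)) (λ π → fromParts (reverse π))
  (λ {F} F∈𝓕 → reverse-isPartition m (toParts F) (toParts-isAscendingPartition m F F∈𝓕))
  (λ {π} π-part → fromParts-isFn m (reverse π) (isPartition-reverse m π π-part))
  (λ {π} π-part → let open IsAscendingPartition (isPartition-reverse m π π-part) in
     trans (cong reverse (toParts-fromParts (reverse π) ascending positive)) (reverse-involutive π))
  (λ {F} F∈𝓕 → trans (cong fromParts (reverse-involutive (toParts F))) (fromParts-toParts (suc m) F F∈𝓕))

schreier⇒length≤ : ∀ n F → T (schreier F) → All (λ a → 1 ≤ a × a ≤ n) F → length F ≤ n
schreier⇒length≤ n []      _   _                = z≤n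
schreier⇒length≤ n (a ∷ l) sch ((_ , a≤n) ∷ _) = ≤-trans (toWitness sch) a≤n

𝓕-enumeration : ∀ n (F : 𝓕 n) → F ∈ restrict (words n (upTo (suc n)))
𝓕-enumeration n (F , F∈𝓕) with isFn⁻ n F F∈𝓕
... | _ , rng , sch , _ =
  ∈-restrict⁺ F∈𝓕 (∈-words⁺ (All.map (λ (_ , a≤n) → ∈-upTo⁺ (s≤s a≤n)) F⊆[1,n]) (schreier⇒length≤ n F sch F⊆[1,n]))
  where
  F⊆[1,n] : All (λ a → 1 ≤ a × a ≤ n) F
  F⊆[1,n] = inRange⇒All n F rng

𝓕-finite : ∀ n → Σ ℕ (λ k → Fin k ↔ 𝓕 n)
𝓕-finite n = enumeration⇒↔Fin (subtype-≟ (≡-dec _≟_)) (restrict (words n (upTo (suc n)))) (𝓕-enumeration n)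

corollary1p3 : (n : ℕ) → n ≥ 1 →
    Σ ℕ (λ k → (Fin k ↔ 𝓕 n) × (Fin k ↔ Partition (n ∸ 1)))
corollary1p3 (suc m) _ =
  let k , Fin↔𝓕 = 𝓕-finite (suc m)
  in k , Fin↔𝓕 , ↔-trans Fin↔𝓕 (𝓕↔Partition m)
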